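{- Let $\mathrm{XORUnification}$ be the XOR-unification algorithm described in the context. For every unification problem $P$ (a finite list of equations between XOR-terms) and every substitution $\sigma$, if $\mathrm{XORUnification}(P)$ returns $\sigma$ (i.e. does not return None), then $\sigma$ solves $P$, i.e. $\sigma(s)\approx_{XOR}\sigma(t)$ for every equation $s\approx^? t$ in $P$.
   Context: Terms are built from constants $C(n)$ ($n\in\mathbb{N}$), variables (indexed by strings), and a binary operator $\oplus$; the constant $0:=C(0)$ is the unit. The relation $\approx_{XOR}$ is the smallest congruence on terms (reflexive, symmetric, transitive, compatible with $\oplus$) containing associativity $(x\oplus y)\oplus z\approx x\oplus(y\oplus z)$, commutativity $x\oplus y\approx y\oplus x$, unity $0\oplus x\approx x$ and nilpotency $x\oplus x\approx 0$. A substitution maps variables to terms (identity on all but finitely many) and is extended homomorphically to terms. A unification problem is a finite list of equations $s\approx^? t$; a substitution solves it if $\sigma(s)\approx_{XOR}\sigma(t)$ for each equation. The algorithm $\mathrm{XORUnification}$: each equation $s\approx^?t$ is rewritten as $s\oplus t\approx^?0$ and the left side is put in a normal form modulo $\approx_{XOR}$ (a list of atoms with cancelled duplicate pairs and removed $0$'s); one starts with the pair $\Gamma\|\Lambda$ with $\Gamma$ these equations and $\Lambda=\emptyset$, and repeatedly applies the first applicable of the rules (Trivial) $\Gamma\cup\{0\approx^?0\}\|\Lambda\ \Rightarrow\ \Gamma\|\Lambda$ and (Variable Substitution) $\Gamma\cup\{x\oplus S\approx^?0\}\|\Lambda\ \Rightarrow\ \sigma\Gamma\|\sigma\Lambda\cup\{x\approx^?S\}$,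 where $x$ is a variable not occurring in $S$ and $\sigma=\{x\mapsto S\}$ (results re-normalized). When no rule applies, if $\Gamma$ is empty the algorithm returns the substitution $\{x\mapsto S : (x\approx^?S)\in\Lambda\}$, and otherwise returns None. -}

module Defs where

open import Data.Nat as ℕ using (ℕ; zero; suc)
open import Data.String as String using (String)
open import Data.List using (List; []; _∷_; _++_; map; foldr; length)
open import Data.Product using (_×_; _,_)
open import Data.Maybe using (Maybe; just; nothing)
open import Data.Bool using (Bool; true; false; _∨_)
open import Relation.Nullary using (yes; no; Dec)
open import Relation.Binary.PropositionalEquality using (_≡_; refl; cong)
open import Data.List.Membership.Propositional using (_∈_)

infixl 6 _⊕_
data Term : Set where
  C   : ℕ → Term
  V   : String → Term
  _⊕_ : Term → Term → Term

𝟘 : Term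
𝟘 = C 0

infix 4 _≈X_
data _≈X_ : Term → Term → Set where
  ≈refl  : ∀ {s} → s ≈X s
  ≈sym   : ∀ {s t} → s ≈X t → t ≈X s
  ≈trans : ∀ {s t u} → s ≈X t → t ≈X u → s ≈X u
  ≈cong  : ∀ {s s′ t t′} → s ≈X s′ → t ≈X t′ → s ⊕ t ≈X s′ ⊕ t′
  assoc  : ∀ x y z → (x ⊕ y) ⊕ z ≈X x ⊕ (y ⊕ z)
  comm   : ∀ x y → x ⊕ y ≈X y ⊕ x
  unit   : ∀ x → 𝟘 ⊕ x ≈X x
  nilp   : ∀ x → x ⊕ x ≈X 𝟘

Subst : Set
Subst = List (String × Term)

lookupVar : Subst → String → Term
lookupVar [] x = V x
lookupVar ((y , t) ∷ σ) x with x String.≟ y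
... | yes _ = t
... | no  _ = lookupVar σ x

apply : Subst → Term → Term
apply σ (C n)   = C n
apply σ (V x)   = lookupVar σ x
apply σ (s ⊕ t) = apply σ s ⊕ apply σ t

Equation : Set
Equation = Term × Term

Problem : Set
Problem = List Equation

Solves : Subst → Problem → Set
Solves σ P = ∀ {s t} → (s , t) ∈ P → apply σ s ≈X apply σ t

data Atom : Set where
  cA : ℕ → Atom
  vA : String → Atom

_≟A_ : (a b : Atom) → Dec (a ≡ b)
cA m ≟A cA n with m ℕ.≟ n
... | yes refl = yes refl
... | no  m≢n  = no (λ { refl → m≢n refl })
cA _ ≟A vA _ = no (λ ())
vA _ ≟A cA _ = no (λ ())
vA x ≟A vA y with x String.≟ y
... | yes refl = yes refl
... | no  x≢y  = no (λ { refl → x≢y refl })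

atomTerm : Atom → Term
atomTerm (cA n) = C n
atomTerm (vA x) = V x

flatten : Term → List Atom
flatten (C n)   = cA n ∷ []
flatten (V x)   = vA x ∷ []
flatten (s ⊕ t) = flatten s ++ flatten t

dropZeros : List Atom → List Atom
dropZeros []              = []
dropZeros (cA zero ∷ as)  = dropZeros as
dropZeros (cA (suc n) ∷ as) = cA (suc n) ∷ dropZeros as
dropZeros (vA x ∷ as)     = vA x ∷ dropZeros as

toggle : Atom → List Atom → List Atom
toggle a [] = a ∷ []
toggle a (b ∷ bs) with a ≟A b
... | yes _ = bs
... | no  _ = b ∷ toggle a bs

normalize : Term → List Atom
normalize t = foldr toggle [] (dropZeros (flatten t))

fromAtoms : List Atom → Term
fromAtoms []       = 𝟘
fromAtoms (a ∷ []) = atomTerm a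
fromAtoms (a ∷ as@(_ ∷ _)) = atomTerm a ⊕ fromAtoms as

-- an equation  S ≈? 0  in normal form
NEq : Set
NEq = List Atom

Solved : Set
Solved = List (String × List Atom)

occursVar : String → List Atom → Bool
occursVar x [] = false
occursVar x (cA _ ∷ as) = occursVar x as
occursVar x (vA y ∷ as) with x String.≟ y
... | yes _ = true
... | no  _ = occursVar x as

removeTrivial : List NEq → Maybe (List NEq)
removeTrivial [] = nothing
removeTrivial ([] ∷ Γ) = just Γ
removeTrivial (e@(_ ∷ _) ∷ Γ) with removeTrivial Γ
... | just Γ′ = just (e ∷ Γ′)
... | nothing = nothing

pickVar : List Atom → List Atom → Maybe (String × List Atom)
pickVar pre [] = nothing
pickVar pre (cA n ∷ as) = pickVar (pre ++ cA n ∷ []) as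
pickVar pre (vA x ∷ as) with occursVar x (pre ++ as)
... | true  = pickVar (pre ++ vA x ∷ []) as
... | false = just (x , pre ++ as)

findEq : List NEq → Maybe (String × List Atom × List NEq)
findEq [] = nothing
findEq (e ∷ Γ) with pickVar [] e
... | just (x , S) = just (x , S , Γ)
... | nothing with findEq Γ
...   | just (x , S , Γ′) = just (x , S , e ∷ Γ′)
...   | nothing = nothing

substAtoms : String → List Atom → List Atom → List Atom
substAtoms x S e = normalize (apply ((x , fromAtoms S) ∷ []) (fromAtoms e))

substSolved : String → List Atom → Solved → Solved
substSolved x S Λ = map (λ { (y , T) → (y , substAtoms x S T) }) Λ

finalize : Solved → Subst
finalize Λ = map (λ { (y , T) → (y , fromAtoms T) }) Λ

-- Every rule application removes one equation from Γ, so  length Γ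
-- steps suffice; the fuel is exactly the initial number of equations.
mutual
  run : ℕ → List NEq → Solved → Maybe Subst
  run n Γ Λ = runTriv n Γ Λ (removeTrivial Γ)

  runTriv : ℕ → List NEq → Solved → Maybe (List NEq) → Maybe Subst
  runTriv (suc n) Γ Λ (just Γ′) = run n Γ′ Λ
  runTriv n Γ Λ _ = runVar n Γ Λ (findEq Γ)

  runVar : ℕ → List NEq → Solved →
           Maybe (String × List Atom × List NEq) → Maybe Subst
  runVar (suc n) Γ Λ (just (x , S , Γ′)) =
    run n (map (substAtoms x S) Γ′) ((x , S) ∷ substSolved x S Λ)
  runVar n []      Λ _ = just (finalize Λ)
  runVar n (_ ∷ _) Λ _ = nothing

XORUnification : Problem → Maybe Subst
XORUnification P =
  run (length P) (map (λ { (s , t) → normalize (s ⊕ t) }) P) []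

-- The pair Γ ‖ Λ stays in solved form: the keys of Λ are distinct and none of
-- them occurs in Γ or in a right-hand side of Λ.  Every rule is sound backwards:
-- a substitution θ satisfying the new pair satisfies the old one.  For (Variable
-- Substitution) this is because θ x ≈ θ S makes θ blind to replacing x by S, and
-- the removed equation x ⊕ S ≈ 0 then holds by nilpotency.  When Γ is empty,
-- solved form makes finalize Λ send each key to its right-hand side and fix that
-- right-hand side, so it satisfies Λ; finally normalization preserves ≈X.
module Submission where

open import Defs
open import Data.Bool using (true; false)
open import Data.Empty using (⊥-elim)
open import Data.List using (List; []; _∷_; _++_; map; foldr; length)
open import Data.List.Properties using (++-assoc)
open import Data.List.Membership.Propositional using (_∈_; _∉_)
open import Data.List.Membership.Propositional.Properties using (∈-map⁺; ∈-map⁻; ∈-++⁺ˡ; ∈-++⁺ʳ; ∈-++⁻)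
open import Data.List.Relation.Binary.Permutation.Propositional using (_↭_; ↭-refl; ↭-trans; ↭-sym; prep; swap)
open import Data.List.Relation.Binary.Permutation.Propositional.Properties using (∈-resp-↭)
open import Data.List.Relation.Binary.Subset.Propositional using (_⊆_)
open import Data.List.Relation.Binary.Subset.Propositional.Properties using (⊆-refl; ⊆-trans; ⊆-reflexive-↭; xs⊆x∷xs; ∷⁺ʳ; ++⁺ʳ)
open import Data.List.Relation.Unary.Any using (here; there)
open import Data.Maybe using (just; nothing)
open import Data.Nat using (zero; suc)
open import Data.Product using (_×_; _,_; ∃-syntax)
open import Data.String as String using (String)
open import Data.Sum using (_⊎_; inj₁; inj₂)
open import Data.Unit using (⊤; tt)
open import Relation.Binary.Bundles using (Setoid)
open import Relation.Binary.PropositionalEquality using (_≡_; _≢_; refl; sym; cong₂; subst)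
open import Relation.Nullary using (yes; no)

≈X-setoid : Setoid _ _
≈X-setoid = record
  { Carrier       = Term
  ; _≈_           = _≈X_
  ; isEquivalence = record { refl = ≈refl ; sym = ≈sym ; trans = ≈trans }
  }

open import Relation.Binary.Reasoning.Setoid ≈X-setoid

⊕-identityʳ : ∀ x → x ⊕ 𝟘 ≈X x
⊕-identityʳ x = ≈trans (comm x 𝟘) (unit x)

⊕-cancelˡ : ∀ a c → a ⊕ (a ⊕ c) ≈X c
⊕-cancelˡ a c = begin
  a ⊕ (a ⊕ c)  ≈⟨ assoc a a c ⟨
  (a ⊕ a) ⊕ c  ≈⟨ ≈cong (nilp a) ≈refl ⟩
  𝟘 ⊕ c        ≈⟨ unit c ⟩
  c            ∎

x⊕yz≈y⊕xz : ∀ a b c → a ⊕ (b ⊕ c) ≈X b ⊕ (a ⊕ c)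
x⊕yz≈y⊕xz a b c = begin
  a ⊕ (b ⊕ c)  ≈⟨ assoc a b c ⟨
  (a ⊕ b) ⊕ c  ≈⟨ ≈cong (comm a b) ≈refl ⟩
  (b ⊕ a) ⊕ c  ≈⟨ assoc b a c ⟩
  b ⊕ (a ⊕ c)  ∎

⊕≈𝟘⇒≈ : ∀ a b → a ⊕ b ≈X 𝟘 → a ≈X b
⊕≈𝟘⇒≈ a b a⊕b≈𝟘 = begin
  a            ≈⟨ ⊕-cancelˡ b a ⟨
  b ⊕ (b ⊕ a)  ≈⟨ ≈cong ≈refl (comm b a) ⟩
  b ⊕ (a ⊕ b)  ≈⟨ ≈cong ≈refl a⊕b≈𝟘 ⟩
  b ⊕ 𝟘        ≈⟨ ⊕-identityʳ b ⟩
  b            ∎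

-- Unlike fromAtoms, this sum is a monoid homomorphism from (List Atom, ++).
⨁ : List Atom → Term
⨁ = foldr (λ a t → atomTerm a ⊕ t) 𝟘

fromAtoms≈⨁ : ∀ as → fromAtoms as ≈X ⨁ as
fromAtoms≈⨁ []               = ≈refl
fromAtoms≈⨁ (a ∷ [])         = ≈sym (⊕-identityʳ (atomTerm a))
fromAtoms≈⨁ (a ∷ as@(_ ∷ _)) = ≈cong ≈refl (fromAtoms≈⨁ as)

⨁-++ : ∀ as bs → ⨁ (as ++ bs) ≈X ⨁ as ⊕ ⨁ bs
⨁-++ []       bs = ≈sym (unit (⨁ bs))
⨁-++ (a ∷ as) bs = ≈trans (≈cong ≈refl (⨁-++ as bs)) (≈sym (assoc _ _ _))

⨁-flatten : ∀ t → ⨁ (flatten t) ≈X t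
⨁-flatten (C n)   = ⊕-identityʳ _
⨁-flatten (V x)   = ⊕-identityʳ _
⨁-flatten (s ⊕ t) = ≈trans (⨁-++ (flatten s) (flatten t)) (≈cong (⨁-flatten s) (⨁-flatten t))

⨁-dropZeros : ∀ as → ⨁ (dropZeros as) ≈X ⨁ as
⨁-dropZeros []                = ≈refl
⨁-dropZeros (cA zero ∷ as)    = ≈trans (⨁-dropZeros as) (≈sym (unit _))
⨁-dropZeros (cA (suc n) ∷ as) = ≈cong ≈refl (⨁-dropZeros as)
⨁-dropZeros (vA x ∷ as)       = ≈cong ≈refl (⨁-dropZeros as)

⨁-toggle : ∀ a bs → ⨁ (toggle a bs) ≈X atomTerm a ⊕ ⨁ bs
⨁-toggle a []       = ≈refl
⨁-toggle a (b ∷ bs) with a ≟A b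
... | yes refl = ≈sym (⊕-cancelˡ (atomTerm a) (⨁ bs))
... | no  _    = ≈trans (≈cong ≈refl (⨁-toggle a bs)) (x⊕yz≈y⊕xz _ _ _)

⨁-foldr-toggle : ∀ as → ⨁ (foldr toggle [] as) ≈X ⨁ as
⨁-foldr-toggle []       = ≈refl
⨁-foldr-toggle (a ∷ as) =
  ≈trans (⨁-toggle a (foldr toggle [] as)) (≈cong ≈refl (⨁-foldr-toggle as))

fromAtoms-normalize : ∀ t → fromAtoms (normalize t) ≈X t
fromAtoms-normalize t = begin
  fromAtoms (normalize t)                      ≈⟨ fromAtoms≈⨁ (normalize t) ⟩
  ⨁ (foldr toggle [] (dropZeros (flatten t)))  ≈⟨ ⨁-foldr-toggle (dropZeros (flatten t)) ⟩
  ⨁ (dropZeros (flatten t))                    ≈⟨ ⨁-dropZeros (flatten t) ⟩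
  ⨁ (flatten t)                                ≈⟨ ⨁-flatten t ⟩
  t                                            ∎

apply-cong : ∀ θ {s t} → s ≈X t → apply θ s ≈X apply θ t
apply-cong θ ≈refl         = ≈refl
apply-cong θ (≈sym p)      = ≈sym (apply-cong θ p)
apply-cong θ (≈trans p q)  = ≈trans (apply-cong θ p) (apply-cong θ q)
apply-cong θ (≈cong p q)   = ≈cong (apply-cong θ p) (apply-cong θ q)
apply-cong θ (assoc x y z) = assoc _ _ _
apply-cong θ (comm x y)    = comm _ _
apply-cong θ (unit x)      = unit _
apply-cong θ (nilp x)      = nilp _

apply-single-absorbed : ∀ θ x S t → apply θ (V x) ≈X apply θ S →
                        apply θ (apply ((x , S) ∷ []) t) ≈X apply θ t
apply-single-absorbed θ x S (C n)   θx≈θS = ≈refl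
apply-single-absorbed θ x S (V y)   θx≈θS with y String.≟ x
... | yes refl = ≈sym θx≈θS
... | no  _    = ≈refl
apply-single-absorbed θ x S (s ⊕ t) θx≈θS =
  ≈cong (apply-single-absorbed θ x S s θx≈θS) (apply-single-absorbed θ x S t θx≈θS)

apply-substAtoms : ∀ θ x S T → apply θ (V x) ≈X apply θ (fromAtoms S) →
                   apply θ (fromAtoms (substAtoms x S T)) ≈X apply θ (fromAtoms T)
apply-substAtoms θ x S T θx≈θS =
  ≈trans (apply-cong θ (fromAtoms-normalize (apply ((x , fromAtoms S) ∷ []) (fromAtoms T))))
         (apply-single-absorbed θ x (fromAtoms S) (fromAtoms T) θx≈θS)

toggle-⊆ : ∀ b bs → toggle b bs ⊆ b ∷ bs
toggle-⊆ b []       = ⊆-refl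
toggle-⊆ b (c ∷ bs) with b ≟A c
... | yes _ = ⊆-trans (xs⊆x∷xs bs c) (xs⊆x∷xs (c ∷ bs) b)
... | no  _ = ⊆-trans (∷⁺ʳ c (toggle-⊆ b bs)) (⊆-reflexive-↭ (swap c b ↭-refl))

foldr-toggle-⊆ : ∀ as → foldr toggle [] as ⊆ as
foldr-toggle-⊆ []       = ⊆-refl
foldr-toggle-⊆ (a ∷ as) = ⊆-trans (toggle-⊆ a _) (∷⁺ʳ a (foldr-toggle-⊆ as))

dropZeros-⊆ : ∀ as → dropZeros as ⊆ as
dropZeros-⊆ []                = ⊆-refl
dropZeros-⊆ (cA zero ∷ as)    = ⊆-trans (dropZeros-⊆ as) (xs⊆x∷xs as _)
dropZeros-⊆ (cA (suc n) ∷ as) = ∷⁺ʳ _ (dropZeros-⊆ as)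
dropZeros-⊆ (vA x ∷ as)       = ∷⁺ʳ _ (dropZeros-⊆ as)

normalize-⊆ : ∀ t → normalize t ⊆ flatten t
normalize-⊆ t = ⊆-trans (foldr-toggle-⊆ _) (dropZeros-⊆ (flatten t))

flatten-atomTerm : ∀ a → flatten (atomTerm a) ≡ a ∷ []
flatten-atomTerm (cA n) = refl
flatten-atomTerm (vA x) = refl

flatten-fromAtoms : ∀ a as → flatten (fromAtoms (a ∷ as)) ≡ a ∷ as
flatten-fromAtoms a []       = flatten-atomTerm a
flatten-fromAtoms a (b ∷ bs) = cong₂ _++_ (flatten-atomTerm a) (flatten-fromAtoms b bs)

vA∈flatten-fromAtoms⁻ : ∀ {z} as → vA z ∈ flatten (fromAtoms as) → vA z ∈ as
vA∈flatten-fromAtoms⁻ []       (here ())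
vA∈flatten-fromAtoms⁻ []       (there ())
vA∈flatten-fromAtoms⁻ (a ∷ as) z∈ = subst (_ ∈_) (flatten-fromAtoms a as) z∈

vA∈flatten-apply-single⁻ : ∀ {z} x S t → vA z ∈ flatten (apply ((x , S) ∷ []) t) →
                           vA z ∈ flatten S ⊎ (vA z ∈ flatten t × z ≢ x)
vA∈flatten-apply-single⁻ x S (C n) (here ())
vA∈flatten-apply-single⁻ x S (C n) (there ())
vA∈flatten-apply-single⁻ x S (V y) z∈ with y String.≟ x
... | yes _ = inj₁ z∈
vA∈flatten-apply-single⁻ x S (V y) (here refl) | no y≢x = inj₂ (here refl , y≢x)
vA∈flatten-apply-single⁻ x S (s ⊕ t) z∈ with ∈-++⁻ (flatten (apply ((x , S) ∷ []) s)) z∈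
... | inj₁ z∈s with vA∈flatten-apply-single⁻ x S s z∈s
...   | inj₁ z∈S         = inj₁ z∈S
...   | inj₂ (z∈s′ , z≢x) = inj₂ (∈-++⁺ˡ z∈s′ , z≢x)
vA∈flatten-apply-single⁻ x S (s ⊕ t) z∈ | inj₂ z∈t with vA∈flatten-apply-single⁻ x S t z∈t
...   | inj₁ z∈S         = inj₁ z∈S
...   | inj₂ (z∈t′ , z≢x) = inj₂ (∈-++⁺ʳ (flatten s) z∈t′ , z≢x)

vA∈substAtoms⁻ : ∀ {z} x S T → vA z ∈ substAtoms x S T → vA z ∈ S ⊎ (vA z ∈ T × z ≢ x)
vA∈substAtoms⁻ x S T z∈
  with vA∈flatten-apply-single⁻ x (fromAtoms S) (fromAtoms T)
         (normalize-⊆ (apply ((x , fromAtoms S) ∷ []) (fromAtoms T)) z∈)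
... | inj₁ z∈S         = inj₁ (vA∈flatten-fromAtoms⁻ S z∈S)
... | inj₂ (z∈T , z≢x) = inj₂ (vA∈flatten-fromAtoms⁻ T z∈T , z≢x)

occursVar-false⇒∉ : ∀ {x} as → occursVar x as ≡ false → vA x ∉ as
occursVar-false⇒∉ []          _ ()
occursVar-false⇒∉ (cA _ ∷ as) h (there x∈) = occursVar-false⇒∉ as h x∈
occursVar-false⇒∉ {x} (vA y ∷ as) h x∈ with x String.≟ y
occursVar-false⇒∉ {x} (vA y ∷ as) () x∈          | yes _
occursVar-false⇒∉ {x} (vA y ∷ as) h (here refl)  | no x≢y = x≢y refl
occursVar-false⇒∉ {x} (vA y ∷ as) h (there x∈)   | no _   = occursVar-false⇒∉ as h x∈

record Picked (e : NEq) (x : String) (S : List Atom) : Set where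
  field
    decompose : ⨁ e ≈X V x ⊕ ⨁ S
    x∉S       : vA x ∉ S
    S⊆e       : S ⊆ e
    x∈e       : vA x ∈ e

pickVar-sound : ∀ pre as {x S} → pickVar pre as ≡ just (x , S) → Picked (pre ++ as) x S
pickVar-sound pre [] ()
pickVar-sound pre (cA n ∷ as) found =
  subst (λ e → Picked e _ _) (++-assoc pre (cA n ∷ []) as) (pickVar-sound _ as found)
pickVar-sound pre (vA y ∷ as) found with occursVar y (pre ++ as) in occurs
... | true  = subst (λ e → Picked e _ _) (++-assoc pre (vA y ∷ []) as) (pickVar-sound _ as found)
pickVar-sound pre (vA y ∷ as) refl | false = record
  { decompose = begin
      ⨁ (pre ++ vA y ∷ as)     ≈⟨ ⨁-++ pre (vA y ∷ as) ⟩
      ⨁ pre ⊕ (V y ⊕ ⨁ as)     ≈⟨ x⊕yz≈y⊕xz (⨁ pre) (V y) (⨁ as) ⟩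
      V y ⊕ (⨁ pre ⊕ ⨁ as)     ≈⟨ ≈cong ≈refl (⨁-++ pre as) ⟨
      V y ⊕ ⨁ (pre ++ as)      ∎
  ; x∉S = occursVar-false⇒∉ (pre ++ as) occurs
  ; S⊆e = ++⁺ʳ pre (xs⊆x∷xs as (vA y))
  ; x∈e = ∈-++⁺ʳ pre (here refl)
  }

findEq-sound : ∀ Γ {x S Γ′} → findEq Γ ≡ just (x , S , Γ′) →
               ∃[ e ] Picked e x S × Γ ↭ e ∷ Γ′
findEq-sound [] ()
findEq-sound (e ∷ Γ) found with pickVar [] e in picked
findEq-sound (e ∷ Γ) refl | just _ = e , pickVar-sound [] e picked , ↭-refl
... | nothing with findEq Γ in foundΓ
findEq-sound (e ∷ Γ) refl | nothing | just _ with findEq-sound Γ foundΓ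
... | d , d-picked , Γ↭ = d , d-picked , ↭-trans (prep e Γ↭) (swap e d ↭-refl)

removeTrivial-sound : ∀ Γ {Γ′} → removeTrivial Γ ≡ just Γ′ → Γ ↭ [] ∷ Γ′
removeTrivial-sound [] ()
removeTrivial-sound ([] ∷ Γ) refl = ↭-refl
removeTrivial-sound (e@(_ ∷ _) ∷ Γ) removed with removeTrivial Γ in removedΓ
removeTrivial-sound (e@(_ ∷ _) ∷ Γ) refl | just _ =
  ↭-trans (prep e (removeTrivial-sound Γ removedΓ)) (swap e [] ↭-refl)

Avoids : Solved → List Atom → Set
Avoids Λ as = ∀ {z T} → (z , T) ∈ Λ → vA z ∉ as

DistinctKeys : Solved → Set
DistinctKeys []            = ⊤
DistinctKeys ((x , _) ∷ Λ) = (∀ {T} → (x , T) ∉ Λ) × DistinctKeys Λ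

record SolvedForm (Γ : List NEq) (Λ : Solved) : Set where
  field
    distinct : DistinctKeys Λ
    Γ-avoids : ∀ {e} → e ∈ Γ → Avoids Λ e
    Λ-avoids : ∀ {y T} → (y , T) ∈ Λ → Avoids Λ T

record Satisfies (θ : Subst) (Γ : List NEq) (Λ : Solved) : Set where
  field
    equations : ∀ {e} → e ∈ Γ → apply θ (fromAtoms e) ≈X 𝟘
    bindings  : ∀ {y T} → (y , T) ∈ Λ → apply θ (V y) ≈X apply θ (fromAtoms T)

open SolvedForm
open Satisfies

∈-substSolved⁺ : ∀ x S Λ {y T} → (y , T) ∈ Λ → (y , substAtoms x S T) ∈ substSolved x S Λ
∈-substSolved⁺ x S (_ ∷ Λ) (here refl) = here refl
∈-substSolved⁺ x S (_ ∷ Λ) (there yT∈) = there (∈-substSolved⁺ x S Λ yT∈)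

∈-substSolved⁻ : ∀ x S Λ {y T′} → (y , T′) ∈ substSolved x S Λ →
                 ∃[ T ] (y , T) ∈ Λ × T′ ≡ substAtoms x S T
∈-substSolved⁻ x S ((y , T) ∷ Λ) (here refl) = T , here refl , refl
∈-substSolved⁻ x S (_ ∷ Λ) (there yT′∈) with ∈-substSolved⁻ x S Λ yT′∈
... | T , yT∈ , T′≡ = T , there yT∈ , T′≡

substSolved-distinct : ∀ x S Λ → DistinctKeys Λ → DistinctKeys (substSolved x S Λ)
substSolved-distinct x S []      _                = tt
substSolved-distinct x S (_ ∷ Λ) (y∉Λ , distinct) =
  (λ yT′∈ → let _ , yT∈ , _ = ∈-substSolved⁻ x S Λ yT′∈ in y∉Λ yT∈)
  , substSolved-distinct x S Λ distinct

lookupVar-finalize-∉ : ∀ Λ {z} → (∀ {T} → (z , T) ∉ Λ) → lookupVar (finalize Λ) z ≡ V z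
lookupVar-finalize-∉ []            z∉ = refl
lookupVar-finalize-∉ ((y , _) ∷ Λ) {z} z∉ with z String.≟ y
... | yes refl = ⊥-elim (z∉ (here refl))
... | no  _    = lookupVar-finalize-∉ Λ (λ zT∈ → z∉ (there zT∈))

lookupVar-finalize-∈ : ∀ Λ → DistinctKeys Λ → ∀ {y T} → (y , T) ∈ Λ →
                       lookupVar (finalize Λ) y ≡ fromAtoms T
lookupVar-finalize-∈ (_ ∷ Λ) _ {y} (here refl) with y String.≟ y
... | yes _   = refl
... | no  y≢y = ⊥-elim (y≢y refl)
lookupVar-finalize-∈ ((x , _) ∷ Λ) (x∉Λ , distinct) {y} (there yT∈) with y String.≟ x
... | yes refl = ⊥-elim (x∉Λ yT∈)
... | no  _    = lookupVar-finalize-∈ Λ distinct yT∈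

apply-finalize-fixes : ∀ Λ t → Avoids Λ (flatten t) → apply (finalize Λ) t ≡ t
apply-finalize-fixes Λ (C n)   _      = refl
apply-finalize-fixes Λ (V z)   avoids = lookupVar-finalize-∉ Λ (λ zT∈ → avoids zT∈ (here refl))
apply-finalize-fixes Λ (s ⊕ t) avoids =
  cong₂ _⊕_ (apply-finalize-fixes Λ s (λ zT∈ z∈ → avoids zT∈ (∈-++⁺ˡ z∈)))
            (apply-finalize-fixes Λ t (λ zT∈ z∈ → avoids zT∈ (∈-++⁺ʳ (flatten s) z∈)))

finalize-satisfies : ∀ Λ → SolvedForm [] Λ → Satisfies (finalize Λ) [] Λ
finalize-satisfies Λ solved = record { equations = λ () ; bindings = binding }
  where
  binding : ∀ {y T} → (y , T) ∈ Λ → apply (finalize Λ) (V y) ≈X apply (finalize Λ) (fromAtoms T)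
  binding {y} {T} yT∈ = begin
    lookupVar (finalize Λ) y          ≡⟨ lookupVar-finalize-∈ Λ (distinct solved) yT∈ ⟩
    fromAtoms T                       ≡⟨ apply-finalize-fixes Λ (fromAtoms T) avoids ⟨
    apply (finalize Λ) (fromAtoms T)  ∎
    where
    avoids : Avoids Λ (flatten (fromAtoms T))
    avoids zU∈ z∈ = Λ-avoids solved yT∈ zU∈ (vA∈flatten-fromAtoms⁻ T z∈)

module _ {Γ Γ′ : List NEq} {Λ : Solved} (Γ↭ : Γ ↭ [] ∷ Γ′) where

  trivial-preserves-SolvedForm : SolvedForm Γ Λ → SolvedForm Γ′ Λ
  trivial-preserves-SolvedForm solved = record
    { distinct = distinct solved
    ; Γ-avoids = λ e∈ → Γ-avoids solved (∈-resp-↭ (↭-sym Γ↭) (there e∈))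
    ; Λ-avoids = Λ-avoids solved
    }

  trivial-reflects-Satisfies : ∀ {θ} → Satisfies θ Γ′ Λ → Satisfies θ Γ Λ
  trivial-reflects-Satisfies {θ} sat = record { equations = equation ; bindings = bindings sat }
    where
    equation : ∀ {e} → e ∈ Γ → apply θ (fromAtoms e) ≈X 𝟘
    equation e∈ with ∈-resp-↭ Γ↭ e∈
    ... | here refl = ≈refl
    ... | there e∈′ = equations sat e∈′

module _ {Γ Γ′ : List NEq} {Λ : Solved} {e : NEq} {x : String} {S : List Atom}
         (picked : Picked e x S) (Γ↭ : Γ ↭ e ∷ Γ′) where

  open Picked picked

  substitution-preserves-SolvedForm :
    SolvedForm Γ Λ → SolvedForm (map (substAtoms x S) Γ′) ((x , S) ∷ substSolved x S Λ)
  substitution-preserves-SolvedForm solved = record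
    { distinct = (λ xT′∈ → let _ , xT∈ , _ = ∈-substSolved⁻ x S Λ xT′∈ in e-avoids xT∈ x∈e)
                 , substSolved-distinct x S Λ (distinct solved)
    ; Γ-avoids = λ d′∈ → let d , d∈ , d′≡ = ∈-map⁻ (substAtoms x S) d′∈ in
                   subst (Avoids _) (sym d′≡)
                     (substAtoms-avoids d (Γ-avoids solved (∈-resp-↭ (↭-sym Γ↭) (there d∈))))
    ; Λ-avoids = λ { (here refl) → S-avoids′
                   ; (there yT′∈) → let T , yT∈ , T′≡ = ∈-substSolved⁻ x S Λ yT′∈ in
                       subst (Avoids _) (sym T′≡) (substAtoms-avoids T (Λ-avoids solved yT∈)) }
    }
    where
    e-avoids : Avoids Λ e
    e-avoids = Γ-avoids solved (∈-resp-↭ (↭-sym Γ↭) (here refl))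

    S-avoids′ : Avoids ((x , S) ∷ substSolved x S Λ) S
    S-avoids′ (here refl) x∈S = x∉S x∈S
    S-avoids′ (there zT′∈) z∈S =
      let _ , zT∈ , _ = ∈-substSolved⁻ x S Λ zT′∈ in e-avoids zT∈ (S⊆e z∈S)

    substAtoms-avoids : ∀ T → Avoids Λ T → Avoids ((x , S) ∷ substSolved x S Λ) (substAtoms x S T)
    substAtoms-avoids T T-avoids zU∈ z∈ with vA∈substAtoms⁻ x S T z∈
    ... | inj₁ z∈S = S-avoids′ zU∈ z∈S
    substAtoms-avoids T T-avoids (here refl)  z∈ | inj₂ (_ , z≢x) = z≢x refl
    substAtoms-avoids T T-avoids (there zU′∈) z∈ | inj₂ (z∈T , _) =
      let _ , zU∈ , _ = ∈-substSolved⁻ x S Λ zU′∈ in T-avoids zU∈ z∈T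

  substitution-reflects-Satisfies :
    ∀ {θ} → Satisfies θ (map (substAtoms x S) Γ′) ((x , S) ∷ substSolved x S Λ) → Satisfies θ Γ Λ
  substitution-reflects-Satisfies {θ} sat = record { equations = equation ; bindings = binding }
    where
    θx≈θS : apply θ (V x) ≈X apply θ (fromAtoms S)
    θx≈θS = bindings sat (here refl)

    equation : ∀ {d} → d ∈ Γ → apply θ (fromAtoms d) ≈X 𝟘
    equation d∈ with ∈-resp-↭ Γ↭ d∈
    ... | here refl = begin
      apply θ (fromAtoms e)                          ≈⟨ apply-cong θ (≈trans (fromAtoms≈⨁ e) decompose) ⟩
      apply θ (V x) ⊕ apply θ (⨁ S)                  ≈⟨ ≈cong θx≈θS (≈sym (apply-cong θ (fromAtoms≈⨁ S))) ⟩
      apply θ (fromAtoms S) ⊕ apply θ (fromAtoms S)  ≈⟨ nilp _ ⟩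
      𝟘                                              ∎
    equation {d} d∈ | there d∈Γ′ = ≈trans (≈sym (apply-substAtoms θ x S d θx≈θS))
                              (equations sat (∈-map⁺ (substAtoms x S) d∈Γ′))

    binding : ∀ {y T} → (y , T) ∈ Λ → apply θ (V y) ≈X apply θ (fromAtoms T)
    binding {T = T} yT∈ = ≈trans (bindings sat (there (∈-substSolved⁺ x S Λ yT∈)))
                                 (apply-substAtoms θ x S T θx≈θS)

run-sound : ∀ n Γ Λ {θ} → run n Γ Λ ≡ just θ → SolvedForm Γ Λ → Satisfies θ Γ Λ
run-sound zero    []      Λ refl solved = finalize-satisfies Λ solved
run-sound zero    (_ ∷ _) Λ ()   solved
run-sound (suc n) Γ Λ ran solved with removeTrivial Γ in removed
... | just Γ′ = trivial-reflects-Satisfies Γ↭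
                  (run-sound n Γ′ Λ ran (trivial-preserves-SolvedForm Γ↭ solved))
  where
  Γ↭ : Γ ↭ [] ∷ Γ′
  Γ↭ = removeTrivial-sound Γ removed
... | nothing with findEq Γ in found
...   | just (x , S , Γ′) with findEq-sound Γ found
...     | _ , picked , Γ↭ = substitution-reflects-Satisfies picked Γ↭
                              (run-sound n _ _ ran (substitution-preserves-SolvedForm picked Γ↭ solved))
run-sound (suc n) []      Λ refl solved | nothing | nothing = finalize-satisfies Λ solved
run-sound (suc n) (_ ∷ _) Λ ()   solved | nothing | nothing

mainTheorem1 : (P : Problem) (σ : Subst) →
               XORUnification P ≡ just σ → Solves σ P
mainTheorem1 P σ unified {s} {t} st∈P = ⊕≈𝟘⇒≈ (apply σ s) (apply σ t) (begin
  apply σ s ⊕ apply σ t                   ≈⟨ apply-cong σ (fromAtoms-normalize (s ⊕ t)) ⟨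
  apply σ (fromAtoms (normalize (s ⊕ t))) ≈⟨ equations sat (∈-map⁺ toNEq st∈P) ⟩
  𝟘                                       ∎)
  where
  toNEq : Equation → NEq
  toNEq (s , t) = normalize (s ⊕ t)

  sat : Satisfies σ (map toNEq P) []
  sat = run-sound (length P) (map toNEq P) [] unified
          record { distinct = tt ; Γ-avoids = λ _ () ; Λ-avoids = λ () }
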